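{- Let $n,m\in\mathbb N$ and $i\in I_{nm}$. If there exist $j,j'\in I_n$, $k,k'\in I_m$ and $\gamma,\gamma'\in SL(2,\mathbb Z)$ such that $\gamma A_jA_k=A_i=\gamma'A_{j'}A_{k'}$, then $j=j'$, $k=k'$ and $\gamma=\gamma'$.
   Context: For $N\in\mathbb N$: $[x:y]_N$ is the class of $(x,y)\in\mathbb Z^2$ under $(x,y)\sim(x',y')$ iff $x'\equiv kx$, $y'\equiv ky\pmod N$ for some $k$ with $\gcd(k,N)=1$; $I_N=\{[x:y]_N:\gcd(x,y,N)=1\}$. $P_N=\{(c,b)\in\mathbb Z^2:c\ge1,c\mid N,0\le b\le N/c-1,\gcd(c,b,N/c)=1\}$ is in bijection with $I_N$ via $(c,b)\mapsto[c:d_N(c,b)]_N$, $d_N(c,b)=\min_{0\le k\le c-1}\{c+b+kN/c:\gcd(c,b+kN/c)=1\}$; for $i\in I_N$ corresponding to $(c,b)$, $A_i=\begin{pmatrix}c&b\\0&N/c\end{pmatrix}$. (Thus $i\mapsto A_i$ is a bijection from $I_N$ onto $X_N^\star=\{\begin{pmatrix}c&b\\0&N/c\end{pmatrix}:(c,b)\in P_N\}$.) -}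

module Defs where

open import Data.Nat as ℕ using (ℕ; _<_; _≤_)
open import Data.Nat.GCD using (gcd)
open import Data.Integer as ℤ using (ℤ; +_; _-_)
open import Data.Integer.Divisibility as ℤD using ()
open import Data.Product using (Σ; _×_; _,_; ∃-syntax)
open import Relation.Binary.PropositionalEquality using (_≡_)

record M2 : Set where
  constructor mat
  field
    a₁₁ a₁₂ a₂₁ a₂₂ : ℤ
open M2 public

infixl 7 _⊗_
_⊗_ : M2 → M2 → M2
mat a b c d ⊗ mat e f g h =
  mat (a ℤ.* e ℤ.+ b ℤ.* g) (a ℤ.* f ℤ.+ b ℤ.* h)
      (c ℤ.* e ℤ.+ d ℤ.* g) (c ℤ.* f ℤ.+ d ℤ.* h)

det : M2 → ℤ
det (mat a b c d) = a ℤ.* d - b ℤ.* c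

SL2 : M2 → Set
SL2 γ = det γ ≡ ℤ.1ℤ

-- I_N : pairs (x,y) ∈ ℤ² with gcd(x,y,N) = 1, taken up to the
-- equivalence relation ~_N (a setoid; quotients are unavailable).

_≡_[mod_] : ℤ → ℤ → ℕ → Set
x ≡ y [mod N ] = (+ N) ℤD.∣ (x - y)

_~[_]_ : ℤ × ℤ → ℕ → ℤ × ℤ → Set
(x , y) ~[ N ] (x' , y') =
  ∃[ k ] (gcd ℤ.∣ k ∣ N ≡ 1 × (x' ≡ k ℤ.* x [mod N ]) × (y' ≡ k ℤ.* y [mod N ]))

InI : ℕ → ℤ × ℤ → Set
InI N (x , y) = gcd (gcd ℤ.∣ x ∣ ℤ.∣ y ∣) N ≡ 1

-- P_N : (c,b) with c ≥ 1, c ∣ N, 0 ≤ b ≤ N/c - 1, gcd(c,b,N/c) = 1.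
-- The quotient N/c is stored as the field q together with c * q ≡ N.

record PElt (N : ℕ) : Set where
  field
    c q b  : ℕ
    c≥1    : 1 ≤ c
    cq≡N   : c ℕ.* q ≡ N
    b<q    : b < q
    gcd≡1  : gcd (gcd c b) q ≡ 1
open PElt public

-- d_N(c,b) = min_{0 ≤ k ≤ c-1} { c + b + k N/c : gcd(c, b + k N/c) = 1 }
-- stated as a relation: "d is that minimum".
IsD : ∀ {N} → PElt N → ℕ → Set
IsD p d =
  (∃[ k ] (k < c p × gcd (c p) (b p ℕ.+ k ℕ.* q p) ≡ 1
           × d ≡ c p ℕ.+ b p ℕ.+ k ℕ.* q p))
  × (∀ k → k < c p → gcd (c p) (b p ℕ.+ k ℕ.* q p) ≡ 1
           → d ≤ c p ℕ.+ b p ℕ.+ k ℕ.* q p)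

-- Corr p i : the element i ∈ I_N (given by a representative) corresponds
-- to p = (c,b) ∈ P_N under (c,b) ↦ [c : d_N(c,b)]_N.
Corr : ∀ {N} → PElt N → ℤ × ℤ → Set
Corr {N} p i = ∃[ d ] (IsD p d × ((+ c p , + d) ~[ N ] i))

A : ∀ {N} → PElt N → M2
A p = mat (+ c p) (+ b p) (+ 0) (+ q p)

{-# OPTIONS --safe #-}
-- An SL(2,ℤ) matrix γ carrying an upper triangular matrix with positive diagonal to another one is
-- a translation (1 x ; 0 1): its lower left entry must vanish, and then ad = 1 with a c_j c_k = c_i ≥ 0
-- forces a = d = 1.  Hence, writing q = N/c, γ A_j A_k = A_i says c_i = c_j c_k, q_i = q_j q_k and
-- b_i = c_j b_k + (b_j + x q_j) q_k.  As gcd(c_i, b_i, q_i) = 1, c_j is coprime to q_k.  For two such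
-- factorisations, c_j c_k = c_j' c_k' and c_k q_k = m = c_k' q_k' give c_j q_k' = c_j' q_k, hence
-- c_j = c_j' and all diagonal entries agree.  Reducing b_i modulo q_k (where c_j is invertible)
-- recovers b_k, and then modulo q_j recovers b_j and x.  Finally, equal elements of P_N have the same
-- d_N, so their representatives are ~_N-equivalent.
module Submission where

open import Defs
open import Data.Nat using (ℕ; _*_; _≤_)
open import Data.Integer using (ℤ)
open import Data.Product using (_×_)
open import Relation.Binary.PropositionalEquality using (_≡_)

open import Data.Nat as ℕ using (suc; _<_; s≤s; z≤n)
import Data.Nat.Properties as ℕ
open import Data.Nat.Divisibility as ℕ using (divides)
open import Data.Nat.Coprimality as Coprimality using (Coprime; coprime-divisor)
open import Data.Nat.GCD using (gcd; gcd-greatest; module Bézout)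
open import Data.Integer as ℤ using (+_; -[1+_]; 0ℤ; 1ℤ; _-_; -_; ∣_∣) renaming (_*_ to _·_; _+_ to _⊕_)
import Data.Integer.Properties as ℤ
import Data.Integer.Divisibility.Signed as ℤ
import Data.Integer.Coprimality as ℤCoprimality
open import Data.Integer.Tactic.RingSolver using (solve-∀)
open import Data.Product using (_,_; proj₁; proj₂; ∃-syntax)
open import Data.Sum using (inj₁)
open import Data.Empty using (⊥-elim)
open import Relation.Binary.PropositionalEquality
  using (_≢_; refl; sym; trans; cong; cong₂; subst; subst₂; module ≡-Reasoning)

translation : ℤ → M2
translation x = mat 1ℤ x 0ℤ 1ℤ

triangular : ℤ → ℤ → ℤ → M2
triangular a b d = mat a b 0ℤ d

mat-cong : ∀ {a a' b b' c c' d d'} → a ≡ a' → b ≡ b' → c ≡ c' → d ≡ d' →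
           mat a b c d ≡ mat a' b' c' d'
mat-cong refl refl refl refl = refl

⊗-assoc : ∀ P Q R → P ⊗ Q ⊗ R ≡ P ⊗ (Q ⊗ R)
⊗-assoc (mat a b c d) (mat e f g h) (mat i j k l) =
  mat-cong (entry a b e f g h i k) (entry a b e f g h j l) (entry c d e f g h i k) (entry c d e f g h j l)
  where
  entry : ∀ a b e f g h i k → (a · e ⊕ b · g) · i ⊕ (a · f ⊕ b · h) · k
                            ≡ a · (e · i ⊕ f · k) ⊕ b · (g · i ⊕ h · k)
  entry = solve-∀

triangular-⊗ : ∀ a b d a' b' d' →
  triangular a b d ⊗ triangular a' b' d' ≡ triangular (a · a') (a · b' ⊕ b · d') (d · d')
triangular-⊗ a b d a' b' d' = mat-cong (l₁ a b a') refl (l₂ a' d) (l₃ b' d d')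
  where
  l₁ : ∀ a b a' → a · a' ⊕ b · 0ℤ ≡ a · a'
  l₁ = solve-∀
  l₂ : ∀ a' d → 0ℤ · a' ⊕ d · 0ℤ ≡ 0ℤ
  l₂ = solve-∀
  l₃ : ∀ b' d d' → 0ℤ · b' ⊕ d · d' ≡ d · d'
  l₃ = solve-∀

translation-⊗-triangular : ∀ x a b d →
  translation x ⊗ triangular a b d ≡ triangular a (b ⊕ x · d) d
translation-⊗-triangular x a b d =
  trans (triangular-⊗ 1ℤ x 1ℤ a b d)
        (mat-cong (ℤ.*-identityˡ a) (cong (_⊕ x · d) (ℤ.*-identityˡ b)) refl (ℤ.*-identityˡ d))

unit-with-nonnegative-multiple⇒≡1 : ∀ {a d C C'} → a · d ≡ 1ℤ → a · + suc C ≡ + C' → a ≡ 1ℤ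
-- The cases with ∣ a ∣ ≢ 1 are discarded by unification against the with-result.
unit-with-nonnegative-multiple⇒≡1 {a} {d} ad≡1 _
  with ℕ.m*n≡1⇒m≡1 ∣ a ∣ ∣ d ∣ (trans (sym (ℤ.abs-* a d)) (cong ∣_∣ ad≡1))
unit-with-nonnegative-multiple⇒≡1 {+ 1}      _ _  | _ = refl
unit-with-nonnegative-multiple⇒≡1 { -[1+ 0 ] } _ () | _

SL2-triangular⇒translation : ∀ {γ C β δ C' β' δ'} → 1 ≤ C → SL2 γ →
  γ ⊗ triangular (+ C) β δ ≡ triangular (+ C') β' δ' → γ ≡ translation (a₁₂ γ)
SL2-triangular⇒translation {mat a x c d} {suc C} (s≤s z≤n) det≡1 eq =
  mat-cong a≡1 refl c≡0 d≡1
  where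
  zero-column : ∀ u v → u · + suc C ⊕ v · 0ℤ ≡ u · + suc C
  zero-column u v = trans (cong (u · + suc C ⊕_) (ℤ.*-zeroʳ v)) (ℤ.+-identityʳ (u · + suc C))
  c≡0 : c ≡ 0ℤ
  c≡0 with ℤ.i*j≡0⇒i≡0∨j≡0 c (trans (sym (zero-column c d)) (cong a₂₁ eq))
  ... | inj₁ c≡0 = c≡0
  ad≡1 : a · d ≡ 1ℤ
  ad≡1 = begin
    a · d           ≡⟨ ℤ.+-identityʳ (a · d) ⟨
    a · d - 0ℤ      ≡⟨ cong (λ z → a · d - z) (ℤ.*-zeroʳ x) ⟨
    a · d - x · 0ℤ  ≡⟨ cong (λ z → a · d - x · z) c≡0 ⟨
    a · d - x · c   ≡⟨ det≡1 ⟩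
    1ℤ              ∎
    where open ≡-Reasoning
  a≡1 : a ≡ 1ℤ
  a≡1 = unit-with-nonnegative-multiple⇒≡1 ad≡1 (trans (sym (zero-column a x)) (cong a₁₁ eq))
  d≡1 : d ≡ 1ℤ
  d≡1 = trans (sym (ℤ.*-identityˡ d)) (trans (cong (_· d) (sym a≡1)) ad≡1)

difference-multiple : ∀ x y u v q → x ⊕ u · q ≡ y ⊕ v · q → x - y ≡ (v - u) · q
difference-multiple x y u v q eq = begin
  x - y                      ≡⟨ subtract-both x y u q ⟩
  (x ⊕ u · q) - (y ⊕ u · q)  ≡⟨ cong (_- (y ⊕ u · q)) eq ⟩
  (y ⊕ v · q) - (y ⊕ u · q)  ≡⟨ cancel y u v q ⟩
  (v - u) · q                ∎
  where
  open ≡-Reasoning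
  subtract-both : ∀ x y u q → x - y ≡ (x ⊕ u · q) - (y ⊕ u · q)
  subtract-both = solve-∀
  cancel : ∀ y u v q → (y ⊕ v · q) - (y ⊕ u · q) ≡ (v - u) · q
  cancel = solve-∀

not-multiple-below : ∀ {a} a' {q} k → a < q → + a - + a' ≢ + suc k · + q
not-multiple-below {a} a' {q} k a<q eq = ℕ.<⇒≱ a<q (begin
  q                 ≤⟨ ℕ.m≤m+n q (k * q) ⟩
  suc k * q         ≤⟨ ℕ.m≤n+m (suc k * q) a' ⟩
  a' ℕ.+ suc k * q  ≡⟨ ℤ.+-injective a'+kq≡a ⟩
  a                 ∎)
  where
  open ℕ.≤-Reasoning
  add-back : ∀ x y → y ⊕ (x - y) ≡ x
  add-back = solve-∀
  a'+kq≡a : + (a' ℕ.+ suc k * q) ≡ + a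
  a'+kq≡a = trans (ℤ.pos-+ a' (suc k * q))
              (trans (cong (+ a' ⊕_) (trans (ℤ.pos-* (suc k) q) (sym eq))) (add-back (+ a) (+ a')))

quotient-zero : ∀ {a} a' {q} w → a < q → a' < q → + a - + a' ≡ w · + q → w ≡ 0ℤ
quotient-zero _ (+ 0)      _   _    _  = refl
quotient-zero a' (+ suc k)  a<q _    eq = ⊥-elim (not-multiple-below a' k a<q eq)
quotient-zero {a} a' {q} -[1+ k ] _ a'<q eq = ⊥-elim (not-multiple-below a k a'<q a'-a≡[1+k]q)
  where
  swap : ∀ x y → y - x ≡ - (x - y)
  swap = solve-∀
  a'-a≡[1+k]q : + a' - + a ≡ + suc k · + q
  a'-a≡[1+k]q = trans (swap (+ a) (+ a')) (trans (cong -_ eq) (ℤ.neg-distribˡ-* -[1+ k ] (+ q)))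

multiple-below⇒≡ : ∀ {a} a' {q} w → a < q → a' < q → + a - + a' ≡ w · + q → a ≡ a'
multiple-below⇒≡ {a} a' {q} w a<q a'<q eq =
  ℤ.+-injective (ℤ.i-j≡0⇒i≡j (+ a) (+ a') (trans eq (cong (_· + q) (quotient-zero a' w a<q a'<q eq))))

euclidean-unique : ∀ {a a' q u v} → a < q → a' < q → + a ⊕ u · + q ≡ + a' ⊕ v · + q → a ≡ a' × u ≡ v
euclidean-unique {a} {a'} {q} {u} {v} a<q a'<q eq =
  multiple-below⇒≡ a' (v - u) a<q a'<q a-a'≡[v-u]q ,
  sym (ℤ.i-j≡0⇒i≡j v u (quotient-zero a' (v - u) a<q a'<q a-a'≡[v-u]q))
  where
  a-a'≡[v-u]q : + a - + a' ≡ (v - u) · + q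
  a-a'≡[v-u]q = difference-multiple (+ a) (+ a') u v (+ q) eq

coprime-euclidean-unique : ∀ {C a a' q u v} → Coprime q C → a < q → a' < q →
  + C · + a ⊕ u · + q ≡ + C · + a' ⊕ v · + q → a ≡ a' × u ≡ v
coprime-euclidean-unique {C} {a} {a'} {q} {u} {v} q⊥C a<q a'<q eq = a≡a' , u≡v
  where
  Ca-Ca'≡[v-u]q : + C · + a - + C · + a' ≡ (v - u) · + q
  Ca-Ca'≡[v-u]q = difference-multiple (+ C · + a) (+ C · + a') u v (+ q) eq
  factor : ∀ c x y → c · (x - y) ≡ c · x - c · y
  factor = solve-∀
  q∣a-a' : + q ℤ.∣ + a - + a'
  q∣a-a' = ℤ.∣ᵤ⇒∣ (ℤCoprimality.coprime-divisor (+ q) (+ C) (+ a - + a') q⊥C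
             (ℤ.∣⇒∣ᵤ (ℤ.divides (v - u) (trans (factor (+ C) (+ a) (+ a')) Ca-Ca'≡[v-u]q))))
  a≡a' : a ≡ a'
  a≡a' = multiple-below⇒≡ a' (ℤ._∣_.quotient q∣a-a') a<q a'<q (ℤ._∣_.equality q∣a-a')
  [v-u]q≡0 : (v - u) · + q ≡ 0ℤ
  [v-u]q≡0 = trans (sym Ca-Ca'≡[v-u]q)
               (trans (cong (λ z → + C · + a - + C · + z) (sym a≡a')) (ℤ.+-inverseʳ (+ C · + a)))
  u≡v : u ≡ v
  u≡v = sym (ℤ.i-j≡0⇒i≡j v u (ℤ.*-cancelʳ-≡ (v - u) 0ℤ (+ q) {{q≢0}} [v-u]q≡0))
    where
    q≢0 : ℕ.NonZero q
    q≢0 = ℕ.>-nonZero (ℕ.≤-<-trans z≤n a<q)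

coprime-*ˡ : ∀ {a b n} → Coprime a n → Coprime b n → Coprime (a * b) n
coprime-*ˡ {a} {b} {n} a⊥n b⊥n {d} (d∣ab , d∣n) = b⊥n (coprime-divisor d⊥a d∣ab , d∣n)
  where
  d⊥a : Coprime d a
  d⊥a (e∣d , e∣a) = a⊥n (e∣a , ℕ.∣-trans e∣d d∣n)

coprime-cross⇒≡ : ∀ {a a' d d'} → Coprime a d → Coprime a' d' → a * d' ≡ a' * d → a ≡ a'
coprime-cross⇒≡ {a} {a'} {d} {d'} a⊥d a'⊥d' ad'≡a'd = ℕ.∣-antisym
  (coprime-divisor a⊥d (divides d' (trans (ℕ.*-comm d a') (trans (sym ad'≡a'd) (ℕ.*-comm a d')))))
  (coprime-divisor a'⊥d' (divides d (trans (ℕ.*-comm d' a) (trans ad'≡a'd (ℕ.*-comm a' d)))))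

PElt-≡ : ∀ {N} {p p' : PElt N} → c p ≡ c p' → q p ≡ q p' → b p ≡ b p' → p ≡ p'
PElt-≡ {p = record { c≥1 = c≥1 ; cq≡N = cq≡N ; b<q = b<q ; gcd≡1 = gcd≡1 }}
       {record { c≥1 = c≥1' ; cq≡N = cq≡N' ; b<q = b<q' ; gcd≡1 = gcd≡1' }} refl refl refl
  rewrite ℕ.≤-irrelevant c≥1 c≥1' | ℕ.≡-irrelevant cq≡N cq≡N'
        | ℕ.<-irrelevant b<q b<q' | ℕ.≡-irrelevant gcd≡1 gcd≡1' = refl

record Factorisation {n m} (γ : M2) (pj : PElt n) (pk : PElt m) (pi : PElt (n * m)) : Set where
  field
    shift         : ℤ
    γ≡translation : γ ≡ translation shift
    c-*           : c pi ≡ c pj * c pk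
    q-*           : q pi ≡ q pj * q pk
    b-shift       : + b pi ≡ + c pj · + b pk ⊕ (+ b pj ⊕ shift · + q pj) · + q pk

factorise : ∀ {n m γ} (pj : PElt n) (pk : PElt m) (pi : PElt (n * m)) →
  SL2 γ → γ ⊗ A pj ⊗ A pk ≡ A pi → Factorisation γ pj pk pi
factorise {γ = γ} pj pk pi det≡1 eq = record
  { shift         = x
  ; γ≡translation = γ≡translation
  ; c-*           = ℤ.+-injective (trans (cong a₁₁ Ai≡) (sym (ℤ.pos-* (c pj) (c pk))))
  ; q-*           = ℤ.+-injective (trans (cong a₂₂ Ai≡) (sym (ℤ.pos-* (q pj) (q pk))))
  ; b-shift       = trans (cong a₁₂ Ai≡) (regroup (+ c pj) (+ b pk) (+ b pj) (+ q pk) x (+ q pj))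
  }
  where
  x C B Q : ℤ
  x = a₁₂ γ
  C = + c pj · + c pk
  B = + c pj · + b pk ⊕ + b pj · + q pk
  Q = + q pj · + q pk
  γ⊗T≡Ai : γ ⊗ triangular C B Q ≡ A pi
  γ⊗T≡Ai = begin
    γ ⊗ triangular C B Q
      ≡⟨ cong (γ ⊗_) (triangular-⊗ (+ c pj) (+ b pj) (+ q pj) (+ c pk) (+ b pk) (+ q pk)) ⟨
    γ ⊗ (A pj ⊗ A pk)     ≡⟨ ⊗-assoc γ (A pj) (A pk) ⟨
    γ ⊗ A pj ⊗ A pk       ≡⟨ eq ⟩
    A pi                  ∎
    where open ≡-Reasoning
  γ≡translation : γ ≡ translation x
  γ≡translation = SL2-triangular⇒translation (ℕ.*-mono-≤ (c≥1 pj) (c≥1 pk)) det≡1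
    (subst (λ z → γ ⊗ triangular z B Q ≡ A pi) (sym (ℤ.pos-* (c pj) (c pk))) γ⊗T≡Ai)
  Ai≡ : A pi ≡ triangular C (B ⊕ x · Q) Q
  Ai≡ = begin
    A pi                              ≡⟨ γ⊗T≡Ai ⟨
    γ ⊗ triangular C B Q              ≡⟨ cong (_⊗ triangular C B Q) γ≡translation ⟩
    translation x ⊗ triangular C B Q  ≡⟨ translation-⊗-triangular x C B Q ⟩
    triangular C (B ⊕ x · Q) Q        ∎
    where open ≡-Reasoning
  regroup : ∀ c₁ b₂ b₁ q₂ x q₁ → c₁ · b₂ ⊕ b₁ · q₂ ⊕ x · (q₁ · q₂) ≡ c₁ · b₂ ⊕ (b₁ ⊕ x · q₁) · q₂
  regroup = solve-∀

factorisation-coprime : ∀ {n m γ} {pj : PElt n} {pk : PElt m} {pi : PElt (n * m)} →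
  Factorisation γ pj pk pi → Coprime (c pj) (q pk)
factorisation-coprime {pj = pj} {pk} {pi} F {g} (g∣c₁ , g∣q₂) =
  ℕ.∣1⇒≡1 (subst (g ℕ.∣_) (gcd≡1 pi) (gcd-greatest (gcd-greatest g∣c g∣b) g∣q))
  where
  open Factorisation F
  g∣c : g ℕ.∣ c pi
  g∣c = subst (g ℕ.∣_) (sym c-*) (ℕ.∣m⇒∣m*n (c pk) g∣c₁)
  g∣q : g ℕ.∣ q pi
  g∣q = subst (g ℕ.∣_) (sym q-*) (ℕ.∣n⇒∣m*n (q pj) g∣q₂)
  g∣b : g ℕ.∣ b pi
  g∣b = ℤ.∣⇒∣ᵤ (subst (+ g ℤ.∣_) (sym b-shift)
          (ℤ.∣m∣n⇒∣m+n (ℤ.∣m⇒∣m*n (+ b pk) (ℤ.∣ᵤ⇒∣ {+ g} {+ c pj} g∣c₁))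
                       (ℤ.∣n⇒∣m*n (+ b pj ⊕ shift · + q pj) (ℤ.∣ᵤ⇒∣ {+ g} {+ q pk} g∣q₂))))

factorisation-diagonal-unique :
  ∀ {n m γ γ'} {pj pj' : PElt n} {pk pk' : PElt m} {pi : PElt (n * m)} →
  Factorisation γ pj pk pi → Factorisation γ' pj' pk' pi →
  c pj ≡ c pj' × q pj ≡ q pj' × c pk ≡ c pk' × q pk ≡ q pk'
factorisation-diagonal-unique {pj = pj} {pj'} {pk} {pk'} F F' = c₁≡ , q₁≡ , c₂≡ , q₂≡
  where
  module F = Factorisation F
  module F' = Factorisation F'
  cancel : ∀ {a x y} → 1 ≤ a → a * x ≡ a * y → x ≡ y
  cancel {a} {x} {y} a≥1 = ℕ.*-cancelˡ-≡ x y a {{ℕ.>-nonZero a≥1}}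
  cross : c pj * q pk' ≡ c pj' * q pk
  cross = cancel (c≥1 pk') (begin
    c pk' * (c pj * q pk')   ≡⟨ ℕ.*-comm (c pk') _ ⟩
    c pj * q pk' * c pk'     ≡⟨ ℕ.*-assoc (c pj) _ _ ⟩
    c pj * (q pk' * c pk')   ≡⟨ cong (c pj *_) (ℕ.*-comm (q pk') _) ⟩
    c pj * (c pk' * q pk')   ≡⟨ cong (c pj *_) (trans (cq≡N pk') (sym (cq≡N pk))) ⟩
    c pj * (c pk * q pk)     ≡⟨ ℕ.*-assoc (c pj) _ _ ⟨
    c pj * c pk * q pk       ≡⟨ cong (_* q pk) (trans (sym F.c-*) F'.c-*) ⟩
    c pj' * c pk' * q pk     ≡⟨ cong (_* q pk) (ℕ.*-comm (c pj') _) ⟩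
    c pk' * c pj' * q pk     ≡⟨ ℕ.*-assoc (c pk') _ _ ⟩
    c pk' * (c pj' * q pk)   ∎)
    where open ≡-Reasoning
  c₁≡ : c pj ≡ c pj'
  c₁≡ = coprime-cross⇒≡ (factorisation-coprime F) (factorisation-coprime F') cross
  q₁≡ : q pj ≡ q pj'
  q₁≡ = cancel (c≥1 pj) (trans (cq≡N pj) (trans (sym (cq≡N pj')) (cong (_* q pj') (sym c₁≡))))
  c₂≡ : c pk ≡ c pk'
  c₂≡ = cancel (c≥1 pj) (trans (sym F.c-*) (trans F'.c-* (cong (_* c pk') (sym c₁≡))))
  q₂≡ : q pk ≡ q pk'
  q₂≡ = cancel (c≥1 pk) (trans (cq≡N pk) (trans (sym (cq≡N pk')) (cong (_* q pk') (sym c₂≡))))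

factorisation-unique : ∀ {n m γ γ'} {pj pj' : PElt n} {pk pk' : PElt m} {pi : PElt (n * m)} →
  Factorisation γ pj pk pi → Factorisation γ' pj' pk' pi → pj ≡ pj' × pk ≡ pk' × γ ≡ γ'
factorisation-unique {pj = pj} {pj'} {pk} {pk'} {pi} F F'
  with factorisation-diagonal-unique F F'
... | c₁≡ , q₁≡ , c₂≡ , q₂≡ =
  PElt-≡ c₁≡ q₁≡ b₁≡ , PElt-≡ c₂≡ q₂≡ b₂≡ ,
  trans F.γ≡translation (trans (cong translation shift≡) (sym F'.γ≡translation))
  where
  module F = Factorisation F
  module F' = Factorisation F'
  b-eq : + c pj · + b pk ⊕ (+ b pj ⊕ F.shift · + q pj) · + q pk
       ≡ + c pj · + b pk' ⊕ (+ b pj' ⊕ F'.shift · + q pj) · + q pk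
  b-eq = begin
    + c pj · + b pk ⊕ (+ b pj ⊕ F.shift · + q pj) · + q pk
      ≡⟨ F.b-shift ⟨
    + b pi
      ≡⟨ F'.b-shift ⟩
    + c pj' · + b pk' ⊕ (+ b pj' ⊕ F'.shift · + q pj') · + q pk'
      ≡⟨ cong₂ (λ c₁ q₂ → + c₁ · + b pk' ⊕ (+ b pj' ⊕ F'.shift · + q pj') · + q₂) c₁≡ q₂≡ ⟨
    + c pj · + b pk' ⊕ (+ b pj' ⊕ F'.shift · + q pj') · + q pk
      ≡⟨ cong (λ q₁ → + c pj · + b pk' ⊕ (+ b pj' ⊕ F'.shift · + q₁) · + q pk) q₁≡ ⟨
    + c pj · + b pk' ⊕ (+ b pj' ⊕ F'.shift · + q pj) · + q pk
      ∎
    where open ≡-Reasoning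
  b₂≡×shifted≡ : b pk ≡ b pk' × + b pj ⊕ F.shift · + q pj ≡ + b pj' ⊕ F'.shift · + q pj
  b₂≡×shifted≡ = coprime-euclidean-unique (Coprimality.sym (factorisation-coprime F))
                   (b<q pk) (subst (b pk' <_) (sym q₂≡) (b<q pk')) b-eq
  b₁≡×shift≡ : b pj ≡ b pj' × F.shift ≡ F'.shift
  b₁≡×shift≡ = euclidean-unique (b<q pj) (subst (b pj' <_) (sym q₁≡) (b<q pj')) (proj₂ b₂≡×shifted≡)
  b₂≡ : b pk ≡ b pk'
  b₂≡ = proj₁ b₂≡×shifted≡
  b₁≡ : b pj ≡ b pj'
  b₁≡ = proj₁ b₁≡×shift≡
  shift≡ : F.shift ≡ F'.shift
  shift≡ = proj₂ b₁≡×shift≡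

mod-sym : ∀ {N} x y → x ≡ y [mod N ] → y ≡ x [mod N ]
mod-sym {N} x y = subst (N ℕ.∣_) (ℤ.∣i-j∣≡∣j-i∣ x y)

mod-trans : ∀ {N} x y z → x ≡ y [mod N ] → y ≡ z [mod N ] → x ≡ z [mod N ]
mod-trans {N} x y z x≡y y≡z = ℤ.∣⇒∣ᵤ (subst (+ N ℤ.∣_) (telescope x y z)
  (ℤ.∣m∣n⇒∣m+n (ℤ.∣ᵤ⇒∣ {+ N} {x - y} x≡y) (ℤ.∣ᵤ⇒∣ {+ N} {y - z} y≡z)))
  where
  telescope : ∀ x y z → (x - y) ⊕ (y - z) ≡ x - z
  telescope = solve-∀

mod-*ˡ : ∀ {N} k x y → x ≡ y [mod N ] → (k · x) ≡ k · y [mod N ]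
mod-*ˡ {N} k x y x≡y =
  ℤ.∣⇒∣ᵤ (subst (+ N ℤ.∣_) (factor k x y) (ℤ.∣n⇒∣m*n k (ℤ.∣ᵤ⇒∣ {+ N} {x - y} x≡y)))
  where
  factor : ∀ k x y → k · (x - y) ≡ k · x - k · y
  factor = solve-∀

≡1+multiple⇒≡1-mod : ∀ {N} u t → u ≡ 1ℤ ⊕ t · + N → u ≡ 1ℤ [mod N ]
≡1+multiple⇒≡1-mod u t eq = ℤ.∣⇒∣ᵤ (ℤ.divides t (trans (cong (_- 1ℤ) eq) (cancel 1ℤ (t · _))))
  where
  cancel : ∀ a b → (a ⊕ b) - a ≡ b
  cancel = solve-∀

coprime⇒invertible-mod : ∀ {N} k → Coprime ∣ k ∣ N → ∃[ w ] ((w · k) ≡ 1ℤ [mod N ])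
coprime⇒invertible-mod {N} (+ a) a⊥N with Coprimality.coprime-Bézout a⊥N
... | Bézout.+- x y 1+yN≡xa = + x , ≡1+multiple⇒≡1-mod (+ x · + a) (+ y) (begin
  + x · + a          ≡⟨ ℤ.pos-* x a ⟨
  + (x * a)          ≡⟨ cong +_ 1+yN≡xa ⟨
  + (1 ℕ.+ y * N)    ≡⟨ cong (1ℤ ⊕_) (ℤ.pos-* y N) ⟩
  1ℤ ⊕ + y · + N     ∎)
  where open ≡-Reasoning
... | Bézout.-+ x y 1+xa≡yN = - + x , ≡1+multiple⇒≡1-mod ((- + x) · + a) (- + y) (begin
  (- + x) · + a        ≡⟨ negate (+ x) (+ a) ⟩
  1ℤ ⊕ - (1ℤ ⊕ + x · + a)  ≡⟨ cong (λ z → 1ℤ ⊕ - (1ℤ ⊕ z)) (ℤ.pos-* x a) ⟨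
  1ℤ ⊕ - + (1 ℕ.+ x * a)   ≡⟨ cong (λ z → 1ℤ ⊕ - + z) 1+xa≡yN ⟩
  1ℤ ⊕ - + (y * N)     ≡⟨ cong (λ z → 1ℤ ⊕ - z) (ℤ.pos-* y N) ⟩
  1ℤ ⊕ - (+ y · + N)   ≡⟨ cong (1ℤ ⊕_) (ℤ.neg-distribˡ-* (+ y) (+ N)) ⟩
  1ℤ ⊕ (- + y) · + N   ∎)
  where
  open ≡-Reasoning
  negate : ∀ x a → (- x) · a ≡ 1ℤ ⊕ - (1ℤ ⊕ x · a)
  negate = solve-∀
coprime⇒invertible-mod {N} -[1+ a ] a⊥N with coprime⇒invertible-mod (+ suc a) a⊥N
... | w , w[1+a]≡1 = - w , subst (λ u → u ≡ 1ℤ [mod N ]) (neg-*-neg w (+ suc a)) w[1+a]≡1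
  where
  neg-*-neg : ∀ w k → w · k ≡ (- w) · (- k)
  neg-*-neg = solve-∀

invertible-mod⇒coprime : ∀ {N w k} → (w · k) ≡ 1ℤ [mod N ] → Coprime ∣ w ∣ N
invertible-mod⇒coprime {N} {w} {k} wk≡1 {g} (g∣w , g∣N) =
  ℕ.∣1⇒≡1 (ℤ.∣⇒∣ᵤ {+ g} {1ℤ} (subst (+ g ℤ.∣_) (difference (w · k))
    (ℤ.∣m∣n⇒∣m-n (ℤ.∣m⇒∣m*n k (ℤ.∣ᵤ⇒∣ {+ g} {w} g∣w))
                 (ℤ.∣-trans (ℤ.∣ᵤ⇒∣ {+ g} {+ N} g∣N) (ℤ.∣ᵤ⇒∣ {+ N} {w · k - 1ℤ} wk≡1)))))
  where
  difference : ∀ u → u - (u - 1ℤ) ≡ 1ℤ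
  difference = solve-∀

~-sym : ∀ {N i j} → i ~[ N ] j → j ~[ N ] i
~-sym {N} {x , y} {x' , y'} (k , k⊥N , x'≡kx , y'≡ky)
  with coprime⇒invertible-mod k (Coprimality.gcd≡1⇒coprime k⊥N)
... | w , wk≡1 = w , Coprimality.coprime⇒gcd≡1 {∣ w ∣} (invertible-mod⇒coprime {N} {w} {k} wk≡1) ,
                 undo x x' x'≡kx , undo y y' y'≡ky
  where
  undo : ∀ x x' → x' ≡ k · x [mod N ] → x ≡ w · x' [mod N ]
  undo x x' x'≡kx = mod-trans x (w · k · x) (w · x') x≡wkx
    (subst (λ u → u ≡ w · x' [mod N ]) (sym (ℤ.*-assoc w k x))
           (mod-*ˡ w (k · x) x' (mod-sym x' (k · x) x'≡kx)))
    where
    x≡wkx : x ≡ w · k · x [mod N ]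
    x≡wkx = mod-sym (w · k · x) x (subst₂ (λ u v → u ≡ v [mod N ]) (ℤ.*-comm x (w · k)) (ℤ.*-identityʳ x)
                                          (mod-*ˡ x (w · k) 1ℤ wk≡1))

~-trans : ∀ {N i j l} → i ~[ N ] j → j ~[ N ] l → i ~[ N ] l
~-trans {N} {x , y} {x' , y'} {x'' , y''} (k , k⊥N , x'≡kx , y'≡ky) (k' , k'⊥N , x''≡k'x' , y''≡k'y') =
  k' · k , k'k⊥N , compose x x' x'' x'≡kx x''≡k'x' , compose y y' y'' y'≡ky y''≡k'y'
  where
  k'k⊥N : gcd ∣ k' · k ∣ N ≡ 1
  k'k⊥N = Coprimality.coprime⇒gcd≡1 (subst (λ u → Coprime u N) (sym (ℤ.abs-* k' k))
            (coprime-*ˡ {∣ k' ∣} {∣ k ∣} (Coprimality.gcd≡1⇒coprime k'⊥N) (Coprimality.gcd≡1⇒coprime k⊥N)))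
  compose : ∀ x x' x'' → x' ≡ k · x [mod N ] → x'' ≡ k' · x' [mod N ] → x'' ≡ k' · k · x [mod N ]
  compose x x' x'' x'≡kx x''≡k'x' = mod-trans x'' (k' · x') (k' · k · x) x''≡k'x'
    (subst (λ u → (k' · x') ≡ u [mod N ]) (sym (ℤ.*-assoc k' k x)) (mod-*ˡ k' x' (k · x) x'≡kx))

IsD-unique : ∀ {N} {p : PElt N} {d d'} → IsD p d → IsD p d' → d ≡ d'
IsD-unique {p = p} D D' = ℕ.≤-antisym (IsD-≤ D D') (IsD-≤ D' D)
  where
  IsD-≤ : ∀ {d d'} → IsD p d → IsD p d' → d ≤ d'
  IsD-≤ (_ , minimal) ((k , k<c , coprime , refl) , _) = minimal k k<c coprime

Corr-unique : ∀ {N} {p : PElt N} {i i'} → Corr p i → Corr p i' → i ~[ N ] i'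
Corr-unique {N} {p} {i} {i'} (d , D , cd~i) (d' , D' , cd~i') with IsD-unique {p = p} D D'
... | refl = ~-trans {N} {i} {+ c p , + d} {i'} (~-sym {N} {+ c p , + d} {i} cd~i) cd~i'

lemma4p5 : (n m : ℕ) → 1 ≤ n → 1 ≤ m →
    (i j j' k k' : ℤ × ℤ) →
    InI (n * m) i → InI n j → InI n j' → InI m k → InI m k' →
    (pi : PElt (n * m)) (pj pj' : PElt n) (pk pk' : PElt m) →
    Corr pi i → Corr pj j → Corr pj' j' → Corr pk k → Corr pk' k' →
    (γ γ' : M2) → SL2 γ → SL2 γ' →
    γ ⊗ A pj ⊗ A pk ≡ A pi → γ' ⊗ A pj' ⊗ A pk' ≡ A pi →
    (j ~[ n ] j') × (k ~[ m ] k') × (γ ≡ γ')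
lemma4p5 n m _ _ _ j j' k k' _ _ _ _ _ pi pj pj' pk pk' _ cj cj' ck ck' γ γ' det≡1 det'≡1 eq eq' =
  Corr-unique {p = pj} {j} {j'} cj (subst (λ p → Corr p j') (sym pj≡pj') cj') ,
  Corr-unique {p = pk} {k} {k'} ck (subst (λ p → Corr p k') (sym pk≡pk') ck') ,
  γ≡γ'
  where
  uniqueness : pj ≡ pj' × pk ≡ pk' × γ ≡ γ'
  uniqueness = factorisation-unique (factorise pj pk pi det≡1 eq) (factorise pj' pk' pi det'≡1 eq')
  pj≡pj' : pj ≡ pj'
  pj≡pj' = proj₁ uniqueness
  pk≡pk' : pk ≡ pk'
  pk≡pk' = proj₁ (proj₂ uniqueness)
  γ≡γ' : γ ≡ γ'
  γ≡γ' = proj₂ (proj₂ uniqueness)
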